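{- Let $c\in\mathbb Q$, $c\neq0$. Then the polynomial $x^4+4x^3+81c^2+27\in\mathbb Q[x]$ has no root in $\mathbb Q$. -}

module Defs where

open import Data.Nat using (ℕ)
open import Data.Integer using (+_)
open import Data.Rational using (ℚ; _+_; _*_; _/_)

κ : ℕ → ℚ
κ n = + n / 1

poly : ℚ → ℚ → ℚ
poly c x = x * x * x * x + κ 4 * (x * x * x) + κ 81 * (c * c) + κ 27

{-# OPTIONS --safe #-}
module Submission where

-- Proof idea: poly c x = (x + 3)² ((x − 1)² + 2) + 81 c², a non-negative
-- term plus a term that is positive as soon as c ≠ 0.

open import Defs
open import Data.Integer using (+[1+_]; -[1+_])
open import Data.Rational using (ℚ; mkℚ; 0ℚ; 1ℚ; _+_; _*_; _-_; NonZero; Positive; NonNegative; ≢-nonZero)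
open import Data.Rational.Properties
  using (_≟_; <-irrefl; positive⁻¹; pos⇒nonNeg; pos*pos⇒pos; neg*neg⇒pos; nonNeg*nonNeg⇒nonNeg; nonNeg+nonNeg⇒nonNeg; nonNeg+pos⇒pos)
open import Data.Rational.Solver using (module +-*-Solver)
open import Relation.Binary.PropositionalEquality using (_≡_; _≢_; refl; sym; subst)
open import Relation.Nullary using (yes; no)

square-pos : ∀ p .{{_ : NonZero p}} → Positive (p * p)
square-pos p@(mkℚ +[1+ _ ] _ _) = pos*pos⇒pos p p
square-pos p@(mkℚ -[1+ _ ] _ _) = neg*neg⇒pos p p

square-nonNeg : ∀ p → NonNegative (p * p)
square-nonNeg p with p ≟ 0ℚ
... | yes refl = _
... | no p≢0   = pos⇒nonNeg (p * p) {{square-pos p {{≢-nonZero p≢0}}}}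

pos⇒≢0 : ∀ p .{{_ : Positive p}} → p ≢ 0ℚ
pos⇒≢0 p p≡0 = <-irrefl (sym p≡0) (positive⁻¹ p)

poly-decomposition : ∀ c x →
  poly c x ≡ (x + κ 3) * (x + κ 3) * ((x - 1ℚ) * (x - 1ℚ) + κ 2) + κ 81 * (c * c)
poly-decomposition = solve 2
  (λ c x → x :* x :* x :* x :+ con (κ 4) :* (x :* x :* x) :+ con (κ 81) :* (c :* c) :+ con (κ 27)
        := (x :+ con (κ 3)) :* (x :+ con (κ 3)) :* ((x :- con 1ℚ) :* (x :- con 1ℚ) :+ con (κ 2))
           :+ con (κ 81) :* (c :* c))
  refl
  where open +-*-Solver

poly-pos : ∀ c .{{_ : NonZero c}} x → Positive (poly c x)
poly-pos c x = subst Positive (sym (poly-decomposition c x))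
  (nonNeg+pos⇒pos (a * b) (κ 81 * (c * c)))
  where
  a = (x + κ 3) * (x + κ 3)
  b = (x - 1ℚ) * (x - 1ℚ) + κ 2
  instance
    a-nonNeg : NonNegative a
    a-nonNeg = square-nonNeg (x + κ 3)
    b-nonNeg : NonNegative b
    b-nonNeg = nonNeg+nonNeg⇒nonNeg ((x - 1ℚ) * (x - 1ℚ)) {{square-nonNeg (x - 1ℚ)}} (κ 2)
    ab-nonNeg : NonNegative (a * b)
    ab-nonNeg = nonNeg*nonNeg⇒nonNeg a b
    c²-pos : Positive (c * c)
    c²-pos = square-pos c
    81c²-pos : Positive (κ 81 * (c * c))
    81c²-pos = pos*pos⇒pos (κ 81) (c * c)

lemma4p8 : (c : ℚ) → c ≢ 0ℚ → (x : ℚ) → poly c x ≢ 0ℚ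
lemma4p8 c c≢0 x = pos⇒≢0 (poly c x) {{poly-pos c {{≢-nonZero c≢0}} x}}
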